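{- For every positive integer $n\equiv 5\pmod 6$ there exists a $3$-SCHGDD of type $(n,3^4)$.
   Context: Let $n,m,t$ be positive integers, $I_n=\{0,1,\dots,n-1\}$, $Z_{mt}$ the integers modulo $mt$, and $S=\{0,t,2t,\dots,(m-1)t\}\subseteq Z_{mt}$. A $3$-HGDD of type $(n,m^t)$ is a quadruple $(X,\mathcal G,\mathcal H,\mathcal B)$ where $X$ is a set of $nmt$ points, $\mathcal G$ is a partition of $X$ into $n$ groups of size $mt$, $\mathcal H$ is a partition of $X$ into $t$ holes of size $nm$ with $|H\cap G|=m$ for every $H\in\mathcal H$, $G\in\mathcal G$, and $\mathcal B$ is a collection of $3$-subsets of $X$ (blocks) such that no block contains two distinct points of the same group or of the same hole, while every other pair of distinct points of $X$ lies in exactly one block. A $3$-SCHGDD of type $(n,m^t)$ is a $3$-HGDD of type $(n,m^t)$ which, up to isomorphism, has $X=I_n\times Z_{mt}$, groups $\{i\}\times Z_{mt}$ ($i\in I_n$), holes $I_n\times(S+l)$ ($0\le l\le t-1$), and block set invariant under $(i,x)\mapsto (i,x+1 \bmod mt)$. -}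

module Defs where

open import Data.Nat using (ℕ; zero; suc; _+_; _*_; _%_; NonZero)
open import Data.Nat.DivMod using (_mod_)
open import Data.Fin using (Fin; toℕ)
open import Data.Product using (_×_; _,_; proj₁; proj₂; ∃; ∃-syntax)
open import Data.Sum using (_⊎_)
open import Data.List using (List; length; lookup)
open import Data.List.Membership.Propositional using (_∈_)
open import Relation.Binary.PropositionalEquality using (_≡_; _≢_)
open import Function.Bundles using (_⇔_)
open import Relation.Nullary using (¬_)

-- Point set X = I_n × Z_k  (k = m t), with Z_k represented by Fin k.
Point : ℕ → ℕ → Set
Point n k = Fin n × Fin k

shiftZ : {k : ℕ} → Fin k → Fin k
shiftZ {suc k} x = suc (toℕ x) mod (suc k)

shiftP : {n k : ℕ} → Point n k → Point n k
shiftP (i , x) = i , shiftZ x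

record Block (n k : ℕ) : Set where
  constructor blk
  field
    p₁ p₂ p₃ : Point n k
open Block public

_∈B_ : {n k : ℕ} → Point n k → Block n k → Set
u ∈B b = u ≡ p₁ b ⊎ u ≡ p₂ b ⊎ u ≡ p₃ b

shiftB : {n k : ℕ} → Block n k → Block n k
shiftB (blk a b c) = blk (shiftP a) (shiftP b) (shiftP c)

module _ (n m t : ℕ) .{{_ : NonZero t}} where

  -- Groups are {i} × Z_{mt}; holes are I_n × (S + l), S = {0, t, ..., (m-1)t},
  -- so (i , x) lies in hole l iff x mod t = l.
  SameGroup : Point n (m * t) → Point n (m * t) → Set
  SameGroup u v = proj₁ u ≡ proj₁ v

  SameHole : Point n (m * t) → Point n (m * t) → Set
  SameHole u v = toℕ (proj₂ u) % t ≡ toℕ (proj₂ v) % t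

  -- a pair of points that must be covered exactly once
  -- (distinctness follows from lying in different groups)
  Admissible : Point n (m * t) → Point n (m * t) → Set
  Admissible u v = (¬ SameGroup u v) × (¬ SameHole u v)

  record SCHGDD : Set where
    field
      blocks : List (Block n (m * t))
      blockOK : ∀ b → b ∈ blocks →
        Admissible (p₁ b) (p₂ b) × Admissible (p₁ b) (p₃ b) × Admissible (p₂ b) (p₃ b)
      pairCovered : ∀ u v → Admissible u v →
        ∃[ i ] ((u ∈B lookup blocks i × v ∈B lookup blocks i) ×
                (∀ j → u ∈B lookup blocks j × v ∈B lookup blocks j → j ≡ i))
      shiftInvariant : ∀ b → b ∈ blocks →
        ∃[ b' ] (b' ∈ blocks × (∀ u → (u ∈B b') ⇔ (u ∈B shiftB b)))

module Submission where

-- Write n = 6k + 5 and h = (n − 1)/2 = 3k + 2.  The points are Z_n × Z₁₂, the groups are the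
-- sets {i} × Z₁₂ and the holes are the classes of the Z₁₂-coordinate modulo 4.  There are three
-- base blocks with a parameter J ∈ {1, …, h},
--   T₁ = {(0,0), (−2J,1), (2J,6)},   T₂ = {(0,0), (2J,1), (3J,3)},   T₃ = {(0,0), (−J,2), (−4J,5)},
-- and the design consists of all their translates by Z_n × Z₁₂.  The 18 ordered pairs of points
-- of a base block ("arcs") realise every Z₁₂-difference ε ∉ {0, 4, 8} exactly twice: once with
-- Z_n-difference +c·J and once with −c·J, where c = c(ε) ∈ {1, 2, 3, 4} is a unit modulo n.
-- Since ±c·1, …, ±c·h run exactly once through the nonzero residues modulo n = 2h + 1, every
-- admissible pair of points lies on exactly one arc of exactly one translate.

open import Defs
open import Level using (0ℓ)
open import Data.Nat
open import Data.Nat.Properties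
  using ( +-comm; +-assoc; +-identityʳ; *-comm; *-assoc; *-identityˡ; *-identityʳ; *-zeroʳ
        ; *-distribʳ-+; suc-injective; +-mono-≤; ≤-trans; m≤m+n; ≮⇒≥; m+n∸n≡m
        ; m∸n+n≡m; ∸-monoʳ-< )
open import Data.Nat.DivMod
  using (_mod_; m%n<n; m%n%n≡m%n; [m+kn]%n≡m%n; m<n⇒m%n≡m; %-distribˡ-+; %-distribˡ-*; m≡m%n+[m/n]*n)
open import Data.Nat.Tactic.RingSolver using (solve-∀)
open import Data.Integer as ℤ using (ℤ; -[1+_]) renaming (+_ to +[_])
open import Data.Integer.Properties using ([1+m]⊖[1+n]≡m⊖n)
open import Data.Fin as Fin using (Fin; toℕ; fromℕ<)
import Data.Fin.Properties as Fin
open import Data.Product using (Σ-syntax; ∃-syntax; _×_; _,_; proj₁; proj₂)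
open import Data.Sum using (_⊎_; inj₁; inj₂)
open import Data.Empty using (⊥-elim)
open import Data.List using (List; []; _∷_; map; lookup; cartesianProduct; allFin)
open import Data.List.Relation.Unary.All as All using ([]; _∷_)
open import Data.List.Relation.Unary.AllPairs using ([]; _∷_)
open import Data.List.Relation.Unary.Any using (here; there; index)
open import Data.List.Relation.Unary.Any.Properties using (lookup-index)
open import Data.List.Membership.Propositional using (_∈_)
open import Data.List.Membership.Propositional.Properties
  using (∈-map⁺; ∈-map⁻; ∈-lookup; ∈-cartesianProduct⁺; ∈-allFin)
open import Data.List.Relation.Unary.Unique.Propositional using (Unique)
open import Data.List.Relation.Unary.Unique.Propositional.Properties
  using (map⁺; cartesianProduct⁺; allFin⁺)
open import Function.Bundles using (_⇔_; mk⇔)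
open import Relation.Nullary using (¬_; Dec; yes; no)
open import Relation.Nullary.Decidable using (toWitness; _×-dec_; _⊎-dec_; ¬?)
open import Relation.Binary.Bundles using (Setoid)
import Relation.Binary.Reasoning.Setoid as SetoidReasoning
open import Relation.Binary.PropositionalEquality

lookup-injective : ∀ {A : Set} {xs : List A} → Unique xs →
                   ∀ i j → lookup xs i ≡ lookup xs j → i ≡ j
lookup-injective (_ ∷ _)   Fin.zero    Fin.zero    _ = refl
lookup-injective (x∉ ∷ _)  Fin.zero    (Fin.suc j) e = ⊥-elim (All.lookup x∉ (∈-lookup j) e)
lookup-injective (x∉ ∷ _)  (Fin.suc i) Fin.zero    e = ⊥-elim (All.lookup x∉ (∈-lookup i) (sym e))
lookup-injective (_ ∷ xs!) (Fin.suc i) (Fin.suc j) e = cong Fin.suc (lookup-injective xs! i j e)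

AdmissibleBlock : ∀ n m t .{{_ : NonZero t}} → Block n (m * t) → Set
AdmissibleBlock n m t B =
  Admissible n m t (p₁ B) (p₂ B) × Admissible n m t (p₁ B) (p₃ B) × Admissible n m t (p₂ B) (p₃ B)

module BlockFamily
  {n m t : ℕ} .{{_ : NonZero t}} {Param : Set}
  (params : List Param) (params-unique : Unique params) (params-complete : ∀ P → P ∈ params)
  (block : Param → Block n (m * t))
  (block-admissible : ∀ P → AdmissibleBlock n m t (block P))
  (pair-covered : ∀ u v → Admissible n m t u v → Σ[ P ∈ Param ] (u ∈B block P × v ∈B block P))
  (pair-unique : ∀ {u v} → Admissible n m t u v → ∀ P P' →
                 u ∈B block P → v ∈B block P → u ∈B block P' → v ∈B block P' → P ≡ P')
  (shift : Param → Param) (block-shift : ∀ P → block (shift P) ≡ shiftB (block P))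
  where

  blocks : List (Block n (m * t))
  blocks = map block params

  -- Distinct parameters give distinct blocks, since a block is determined by any admissible pair in it.
  block-injective : ∀ {P P'} → block P ≡ block P' → P ≡ P'
  block-injective {P} e = pair-unique (proj₁ (block-admissible P)) _ _
    (inj₁ refl) (inj₂ (inj₁ refl))
    (subst (p₁ (block P) ∈B_) e (inj₁ refl)) (subst (p₂ (block P) ∈B_) e (inj₂ (inj₁ refl)))

  listed : ∀ {B} → B ∈ blocks → Σ[ P ∈ Param ] B ≡ block P
  listed B∈ with ∈-map⁻ block B∈
  ... | P , _ , B≡ = P , B≡

  blocks-admissible : ∀ B → B ∈ blocks → AdmissibleBlock n m t B
  blocks-admissible B B∈ with listed B∈
  ... | P , refl = block-admissible P

  -- An admissible pair lies in the block of its unique parameter; any listed block containing the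
  -- pair has that same parameter, hence sits at the same position of the duplicate-free list.
  blocks-cover : ∀ u v → Admissible n m t u v →
    ∃[ i ] ((u ∈B lookup blocks i × v ∈B lookup blocks i) ×
            (∀ j → u ∈B lookup blocks j × v ∈B lookup blocks j → j ≡ i))
  blocks-cover u v uv = index P∈ , (at-i u∈P , at-i v∈P) , only-i
    where
    P = proj₁ (pair-covered u v uv)
    u∈P = proj₁ (proj₂ (pair-covered u v uv))
    v∈P = proj₂ (proj₂ (pair-covered u v uv))
    P∈ : block P ∈ blocks
    P∈ = ∈-map⁺ block (params-complete P)
    at-i : ∀ {w} → w ∈B block P → w ∈B lookup blocks (index P∈)
    at-i = subst (_ ∈B_) (lookup-index P∈)
    only-i : ∀ j → u ∈B lookup blocks j × v ∈B lookup blocks j → j ≡ index P∈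
    only-i j (u∈j , v∈j) with listed (∈-lookup {xs = blocks} j)
    ... | P' , j≡P' = lookup-injective (map⁺ block-injective params-unique) j (index P∈)
      (trans j≡P' (trans (cong block P'≡P) (lookup-index P∈)))
      where
      P'≡P : P' ≡ P
      P'≡P = pair-unique uv P' P (subst (u ∈B_) j≡P' u∈j) (subst (v ∈B_) j≡P' v∈j) u∈P v∈P

  blocks-shift : ∀ B → B ∈ blocks → ∃[ B' ] (B' ∈ blocks × (∀ u → (u ∈B B') ⇔ (u ∈B shiftB B)))
  blocks-shift B B∈ with listed B∈
  ... | P , refl = block (shift P) , ∈-map⁺ block (params-complete (shift P)) ,
        λ u → mk⇔ (subst (u ∈B_) (block-shift P)) (subst (u ∈B_) (sym (block-shift P)))

  design : SCHGDD n m t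
  design = record
    { blocks         = blocks
    ; blockOK        = blocks-admissible
    ; pairCovered    = blocks-cover
    ; shiftInvariant = blocks-shift
    }

-- A sign ±, used to write the nonzero residues modulo 2h + 1 as ±1, …, ±h.
data Sign : Set where
  plus minus : Sign

signedℤ : Sign → ℕ → ℤ
signedℤ plus  c = +[ c ]
signedℤ minus c = ℤ.- +[ c ]

-- Arithmetic modulo N = suc M on natural numbers; M represents −1, so M * x represents −x.
-- Residues are compared through _%_, and Fin N is linked to ℕ through toℕ and _mod_.
module Congruence (M : ℕ) where

  N : ℕ
  N = suc M

  infix 4 _≈_
  record _≈_ (x y : ℕ) : Set where
    constructor mod-eq
    field same-residue : x % N ≡ y % N

  ≈-refl : ∀ {x} → x ≈ x
  ≈-refl = mod-eq refl

  ≈-sym : ∀ {x y} → x ≈ y → y ≈ x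
  ≈-sym (mod-eq p) = mod-eq (sym p)

  ≈-trans : ∀ {x y z} → x ≈ y → y ≈ z → x ≈ z
  ≈-trans (mod-eq p) (mod-eq q) = mod-eq (trans p q)

  ≡⇒≈ : ∀ {x y} → x ≡ y → x ≈ y
  ≡⇒≈ refl = ≈-refl

  ≈-setoid : Setoid 0ℓ 0ℓ
  ≈-setoid = record
    { Carrier = ℕ ; _≈_ = _≈_
    ; isEquivalence = record { refl = ≈-refl ; sym = ≈-sym ; trans = ≈-trans } }

  module ≈-Reasoning = SetoidReasoning ≈-setoid

  +-cong : ∀ {a b c d} → a ≈ b → c ≈ d → a + c ≈ b + d
  +-cong {a} {b} {c} {d} (mod-eq p) (mod-eq q) = mod-eq (begin
    (a + c) % N           ≡⟨ %-distribˡ-+ a c N ⟩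
    (a % N + c % N) % N   ≡⟨ cong₂ (λ x y → (x + y) % N) p q ⟩
    (b % N + d % N) % N   ≡⟨ %-distribˡ-+ b d N ⟨
    (b + d) % N           ∎)
    where open ≡-Reasoning

  *-cong : ∀ {a b c d} → a ≈ b → c ≈ d → a * c ≈ b * d
  *-cong {a} {b} {c} {d} (mod-eq p) (mod-eq q) = mod-eq (begin
    (a * c) % N             ≡⟨ %-distribˡ-* a c N ⟩
    (a % N * (c % N)) % N   ≡⟨ cong₂ (λ x y → (x * y) % N) p q ⟩
    (b % N * (d % N)) % N   ≡⟨ %-distribˡ-* b d N ⟨
    (b * d) % N             ∎)
    where open ≡-Reasoning

  ≡+N*⇒≈ : ∀ {x y} q → x ≡ y + N * q → x ≈ y
  ≡+N*⇒≈ {y = y} q refl =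
    mod-eq (trans (cong (λ z → (y + z) % N) (*-comm N q)) ([m+kn]%n≡m%n y q N))

  -- Addition is cancellative on both sides: subtracting a is adding M * a.
  +-cancelˡ : ∀ a {x y} → a + x ≈ a + y → x ≈ y
  +-cancelˡ a {x} {y} a+x≈a+y = begin
    x               ≈⟨ ≡+N*⇒≈ a (absorb M a x) ⟨
    M * a + (a + x) ≈⟨ +-cong (≈-refl {M * a}) a+x≈a+y ⟩
    M * a + (a + y) ≈⟨ ≡+N*⇒≈ a (absorb M a y) ⟩
    y               ∎
    where
    open ≈-Reasoning
    absorb : ∀ m a z → m * a + (a + z) ≡ z + suc m * a
    absorb = solve-∀

  +-cancelʳ : ∀ a {x y} → x + a ≈ y + a → x ≈ y
  +-cancelʳ a {x} {y} x+a≈y+a =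
    +-cancelˡ a (≈-trans (≡⇒≈ (+-comm a x)) (≈-trans x+a≈y+a (≡⇒≈ (+-comm y a))))

  ≈⇒≡ : ∀ {x y} → x < N → y < N → x ≈ y → x ≡ y
  ≈⇒≡ x<N y<N (mod-eq e) = trans (sym (m<n⇒m%n≡m x<N)) (trans e (m<n⇒m%n≡m y<N))

  positive-≉0 : ∀ {x} → 0 < x → x < N → ¬ x ≈ 0
  positive-≉0 0<x x<N x≈0 with ≈⇒≡ x<N z<s x≈0
  positive-≉0 () _ _ | refl

  %-≈ : ∀ x → x % N ≈ x
  %-≈ x = mod-eq (m%n%n≡m%n x N)

  toℕ-mod : ∀ x → toℕ (x mod N) ≈ x
  toℕ-mod x = ≈-trans (≡⇒≈ (Fin.toℕ-fromℕ< (m%n<n x N))) (%-≈ x)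

  toℕ-≈-injective : ∀ {i j : Fin N} → toℕ i ≈ toℕ j → i ≡ j
  toℕ-≈-injective {i} {j} e = Fin.toℕ-injective (≈⇒≡ (Fin.toℕ<n i) (Fin.toℕ<n j) e)

  mod≡⇒≈ : ∀ {x} {i : Fin N} → x mod N ≡ i → x ≈ toℕ i
  mod≡⇒≈ {x} refl = ≈-sym (toℕ-mod x)

  ≈⇒mod≡ : ∀ {x} {i : Fin N} → x ≈ toℕ i → x mod N ≡ i
  ≈⇒mod≡ {x} e = toℕ-≈-injective (≈-trans (toℕ-mod x) e)

  shift-translate : ∀ (b : Fin N) y → shiftZ ((toℕ b + y) mod N) ≡ (toℕ (shiftZ b) + y) mod N
  shift-translate b y = ≈⇒mod≡ (begin
    suc (toℕ ((toℕ b + y) mod N)) ≈⟨ +-cong (≈-refl {1}) (toℕ-mod (toℕ b + y)) ⟩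
    suc (toℕ b) + y               ≈⟨ +-cong (toℕ-mod (suc (toℕ b))) (≈-refl {y}) ⟨
    toℕ (shiftZ b) + y            ≈⟨ toℕ-mod (toℕ (shiftZ b) + y) ⟨
    toℕ ((toℕ (shiftZ b) + y) mod N) ∎)
    where open ≈-Reasoning

  translate-difference : ∀ a {x y d} → y ≈ x + d → toℕ ((a + y) mod N) ≈ toℕ ((a + x) mod N) + d
  translate-difference a {x} {y} {d} y≈x+d = begin
    toℕ ((a + y) mod N)      ≈⟨ toℕ-mod (a + y) ⟩
    a + y                    ≈⟨ +-cong (≈-refl {a}) y≈x+d ⟩
    a + (x + d)              ≡⟨ +-assoc a x d ⟨
    a + x + d                ≈⟨ +-cong (toℕ-mod (a + x)) (≈-refl {d}) ⟨
    toℕ ((a + x) mod N) + d  ∎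
    where open ≈-Reasoning

  -- If y ≈ x + d, then the translate sending x to i sends y to i + d; this is how a base block is
  -- moved onto a given pair of points.
  translate-to : ∀ (i j : Fin N) {x y d} → y ≈ x + d → toℕ j ≈ toℕ i + d →
                 (toℕ ((toℕ i + M * x) mod N) + y) mod N ≡ j
  translate-to i j {x} {y} {d} y≈x+d j≈i+d = ≈⇒mod≡ (begin
    toℕ ((toℕ i + M * x) mod N) + y ≈⟨ +-cong (toℕ-mod (toℕ i + M * x)) y≈x+d ⟩
    (toℕ i + M * x) + (x + d)       ≈⟨ ≡+N*⇒≈ x (regroup M (toℕ i) x d) ⟩
    toℕ i + d                       ≈⟨ j≈i+d ⟨
    toℕ j                           ∎)
    where
    open ≈-Reasoning
    regroup : ∀ m i x d → (i + m * x) + (x + d) ≡ (i + d) + suc m * x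
    regroup = solve-∀

  translate-to-base : ∀ (i : Fin N) x → (toℕ ((toℕ i + M * x) mod N) + x) mod N ≡ i
  translate-to-base i x =
    translate-to i i (≡⇒≈ (sym (+-identityʳ x))) (≡⇒≈ (sym (+-identityʳ (toℕ i))))

  translate-injective : ∀ {i j : Fin N} x → (toℕ i + x) mod N ≡ (toℕ j + x) mod N → i ≡ j
  translate-injective {j = j} x e =
    toℕ-≈-injective (+-cancelʳ x (≈-trans (mod≡⇒≈ e) (toℕ-mod (toℕ j + x))))

  neg-inverse : ∀ x → x + M * x ≈ 0
  neg-inverse x = ≡+N*⇒≈ x refl

  complement-neg : ∀ {x y} → x + y ≡ N → M * x ≈ y
  complement-neg {x} {y} x+y≡N = +-cancelˡ x (begin
    x + M * x ≈⟨ neg-inverse x ⟩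
    0         ≈⟨ ≡+N*⇒≈ 1 (sym (*-identityʳ N)) ⟨
    N         ≡⟨ x+y≡N ⟨
    x + y     ∎)
    where open ≈-Reasoning

  difference-≈ : ∀ x y → y ≈ x + (y + M * x)
  difference-≈ x y = ≈-sym (≡+N*⇒≈ x (regroup M x y))
    where
    regroup : ∀ m x y → x + (y + m * x) ≡ y + suc m * x
    regroup = solve-∀

  difference-≉0 : ∀ {i j : Fin N} → i ≢ j → ¬ toℕ j + M * toℕ i ≈ 0
  difference-≉0 {i} {j} i≢j d≈0 = i≢j (toℕ-≈-injective (begin
    toℕ i                           ≡⟨ +-identityʳ (toℕ i) ⟨
    toℕ i + 0                       ≈⟨ +-cong (≈-refl {toℕ i}) d≈0 ⟨
    toℕ i + (toℕ j + M * toℕ i)     ≈⟨ difference-≈ (toℕ i) (toℕ j) ⟨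
    toℕ j                           ∎))
    where open ≈-Reasoning

  Unit : ℕ → Set
  Unit c = Σ[ d ∈ ℕ ] d * c ≈ 1

  unit-cancel : ∀ {c} → Unit c → ∀ {x y} → c * x ≈ c * y → x ≈ y
  unit-cancel {c} (d , dc≈1) {x} {y} cx≈cy = begin
    x           ≡⟨ *-identityˡ x ⟨
    1 * x       ≈⟨ *-cong dc≈1 (≈-refl {x}) ⟨
    d * c * x   ≡⟨ *-assoc d c x ⟩
    d * (c * x) ≈⟨ *-cong (≈-refl {d}) cx≈cy ⟩
    d * (c * y) ≡⟨ *-assoc d c y ⟨
    d * c * y   ≈⟨ *-cong dc≈1 (≈-refl {y}) ⟩
    1 * y       ≡⟨ *-identityˡ y ⟩
    y           ∎
    where open ≈-Reasoning

  unit-divides : ∀ {c} (u : Unit c) δ → c * (proj₁ u * δ) ≈ δ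
  unit-divides {c} (d , dc≈1) δ = begin
    c * (d * δ) ≡⟨ rotate c d δ ⟩
    d * c * δ   ≈⟨ *-cong dc≈1 (≈-refl {δ}) ⟩
    1 * δ       ≡⟨ *-identityˡ δ ⟩
    δ           ∎
    where
    open ≈-Reasoning
    rotate : ∀ c d δ → c * (d * δ) ≡ d * c * δ
    rotate = solve-∀

  unit-* : ∀ {c c'} → Unit c → Unit c' → Unit (c * c')
  unit-* {c} {c'} (d , dc≈1) (d' , d'c'≈1) = d' * d , (begin
    d' * d * (c * c')   ≡⟨ regroup d' d c c' ⟩
    d' * (d * c * c')   ≈⟨ *-cong (≈-refl {d'}) (*-cong dc≈1 (≈-refl {c'})) ⟩
    d' * (1 * c')       ≡⟨ cong (d' *_) (*-identityˡ c') ⟩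
    d' * c'             ≈⟨ d'c'≈1 ⟩
    1                   ∎)
    where
    open ≈-Reasoning
    regroup : ∀ a b c d → a * b * (c * d) ≡ a * (b * c * d)
    regroup = solve-∀

  neg-unit : Unit M
  neg-unit = M , (begin
    M * M           ≈⟨ ≡+N*⇒≈ 1 refl ⟨
    M * M + N * 1   ≡⟨ square M ⟩
    1 + N * M       ≈⟨ ≡+N*⇒≈ M refl ⟩
    1               ∎)
    where
    open ≈-Reasoning
    square : ∀ m → m * m + suc m * 1 ≡ 1 + suc m * m
    square = solve-∀

  -- The ring map ℤ → ℤ/N, sending −(a + 1) to M * (a + 1).  Base blocks are written with integer
  -- coefficients and transported to Z_n by it.
  ⟦_⟧ : ℤ → ℕ
  ⟦ +[ a ] ⟧  = a
  ⟦ -[1+ a ] ⟧ = M * suc a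

  ⟦⊖⟧ : ∀ a b → ⟦ a ℤ.⊖ b ⟧ ≈ a + M * b
  ⟦⊖⟧ a       zero    = ≡⇒≈ (sym (trans (cong (a +_) (*-zeroʳ M)) (+-identityʳ a)))
  ⟦⊖⟧ zero    (suc b) = ≈-refl
  ⟦⊖⟧ (suc a) (suc b) = begin
    ⟦ suc a ℤ.⊖ suc b ⟧ ≡⟨ cong ⟦_⟧ ([1+m]⊖[1+n]≡m⊖n a b) ⟩
    ⟦ a ℤ.⊖ b ⟧         ≈⟨ ⟦⊖⟧ a b ⟩
    a + M * b           ≈⟨ ≡+N*⇒≈ 1 (step M a b) ⟨
    suc a + M * suc b   ∎
    where
    open ≈-Reasoning
    step : ∀ m a b → suc a + m * suc b ≡ (a + m * b) + suc m * 1
    step = solve-∀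

  ⟦+⟧ : ∀ x y → ⟦ x ℤ.+ y ⟧ ≈ ⟦ x ⟧ + ⟦ y ⟧
  ⟦+⟧ +[ a ]   +[ b ]   = ≈-refl
  ⟦+⟧ +[ a ]   -[1+ b ] = ⟦⊖⟧ a (suc b)
  ⟦+⟧ -[1+ a ] +[ b ]   = ≈-trans (⟦⊖⟧ b (suc a)) (≡⇒≈ (+-comm b (M * suc a)))
  ⟦+⟧ -[1+ a ] -[1+ b ] = ≡⇒≈ (sum M a b)
    where
    sum : ∀ m a b → m * suc (suc (a + b)) ≡ m * suc a + m * suc b
    sum = solve-∀

  signed : Sign → ℕ → ℕ
  signed plus  J = J
  signed minus J = M * J

  ⟦signedℤ⟧ : ∀ s c J → ⟦ signedℤ s c ⟧ * J ≡ c * signed s J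
  ⟦signedℤ⟧ plus  c       J = refl
  ⟦signedℤ⟧ minus zero    J = refl
  ⟦signedℤ⟧ minus (suc c) J = swap M (suc c) J
    where
    swap : ∀ m c j → m * c * j ≡ c * (m * j)
    swap = solve-∀

  scaled-difference : ∀ {x x'} s c J → x' ≡ x ℤ.+ signedℤ s c →
                      ⟦ x' ⟧ * J ≈ ⟦ x ⟧ * J + c * signed s J
  scaled-difference {x} s c J refl = begin
    ⟦ x ℤ.+ signedℤ s c ⟧ * J           ≈⟨ *-cong (⟦+⟧ x (signedℤ s c)) (≈-refl {J}) ⟩
    (⟦ x ⟧ + ⟦ signedℤ s c ⟧) * J        ≡⟨ *-distribʳ-+ J ⟦ x ⟧ _ ⟩
    ⟦ x ⟧ * J + ⟦ signedℤ s c ⟧ * J      ≡⟨ cong (⟦ x ⟧ * J +_) (⟦signedℤ⟧ s c J) ⟩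
    ⟦ x ⟧ * J + c * signed s J           ∎
    where open ≈-Reasoning

module HalfSystem (h : ℕ) where

  M : ℕ
  M = h + h

  open Congruence M public

  rep : Fin h → ℕ
  rep j = suc (toℕ j)

  rep≤h : ∀ j → rep j ≤ h
  rep≤h j = Fin.toℕ<n j

  rep-sum<N : ∀ j j' → rep j + rep j' < N
  rep-sum<N j j' = s≤s (+-mono-≤ (rep≤h j) (rep≤h j'))

  rep<N : ∀ j → rep j < N
  rep<N j = s≤s (≤-trans (rep≤h j) (m≤m+n h h))

  rep-≉0 : ∀ j → ¬ rep j ≈ 0
  rep-≉0 j = positive-≉0 z<s (rep<N j)

  rep-injective : ∀ {j j'} → rep j ≈ rep j' → j ≡ j'
  rep-injective {j} {j'} e = Fin.toℕ-injective (suc-injective (≈⇒≡ (rep<N j) (rep<N j') e))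

  -- J ≢ −J', because J + J' ≢ 0.
  opposite-≉ : ∀ j j' → ¬ rep j ≈ M * rep j'
  opposite-≉ j j' e = positive-≉0 z<s (rep-sum<N j' j)
    (≈-trans (+-cong (≈-refl {rep j'}) e) (neg-inverse (rep j')))

  signed-injective : ∀ s s' j j' → signed s (rep j) ≈ signed s' (rep j') → s ≡ s' × j ≡ j'
  signed-injective plus  plus  j j' e = refl , rep-injective e
  signed-injective minus minus j j' e = refl , rep-injective (unit-cancel neg-unit e)
  signed-injective plus  minus j j' e = ⊥-elim (opposite-≉ j j' e)
  signed-injective minus plus  j j' e = ⊥-elim (opposite-≉ j' j (≈-sym e))

  signed-≉0 : ∀ s j → ¬ signed s (rep j) ≈ 0
  signed-≉0 plus  j e = rep-≉0 j e
  signed-≉0 minus j e = rep-≉0 j (unit-cancel neg-unit (≈-trans e (≡⇒≈ (sym (*-zeroʳ M)))))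

  -- Every nonzero residue r is ±J: take +r if r ≤ h and −(N − r) otherwise.
  signed-surjective : ∀ δ → ¬ δ ≈ 0 → Σ[ s ∈ Sign ] Σ[ j ∈ Fin h ] signed s (rep j) ≈ δ
  signed-surjective δ δ≉0 = represent (δ % N) (m%n<n δ N) (%-≈ δ)
    where
    represent : ∀ r → r < N → r ≈ δ → Σ[ s ∈ Sign ] Σ[ j ∈ Fin h ] signed s (rep j) ≈ δ
    represent zero    _   0≈δ = ⊥-elim (δ≉0 (≈-sym 0≈δ))
    represent (suc q) r<N r≈δ with q <? h
    ... | yes q<h = plus , fromℕ< q<h , ≈-trans (≡⇒≈ (cong suc (Fin.toℕ-fromℕ< q<h))) r≈δ
    ... | no  q≮h = minus , fromℕ< j<h , ≈-trans (complement-neg complement) r≈δ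
      where
      q<M : suc q ≤ M
      q<M = s≤s⁻¹ r<N
      j<h : M ∸ suc q < h
      j<h = subst (M ∸ suc q <_) (m+n∸n≡m h h) (∸-monoʳ-< (s≤s (≮⇒≥ q≮h)) q<M)
      complement : rep (fromℕ< j<h) + suc q ≡ N
      complement = begin
        suc (toℕ (fromℕ< j<h)) + suc q ≡⟨ cong (λ z → suc z + suc q) (Fin.toℕ-fromℕ< j<h) ⟩
        suc (M ∸ suc q + suc q)        ≡⟨ cong suc (m∸n+n≡m q<M) ⟩
        N                              ∎
        where open ≡-Reasoning

  two-unit : Unit 2
  two-unit = suc h , ≡+N*⇒≈ 1 (double h)
    where
    double : ∀ h → suc h * 2 ≡ 1 + suc (h + h) * 1
    double = solve-∀

  module Scaled {c : ℕ} (c-unit : Unit c) where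

    scaled-injective : ∀ {s s' j j'} → c * signed s (rep j) ≈ c * signed s' (rep j') →
                       s ≡ s' × j ≡ j'
    scaled-injective {s} {s'} {j} {j'} e = signed-injective s s' j j' (unit-cancel c-unit e)

    scaled-≉0 : ∀ s j → ¬ c * signed s (rep j) ≈ 0
    scaled-≉0 s j e = signed-≉0 s j (unit-cancel c-unit (≈-trans e (≡⇒≈ (sym (*-zeroʳ c)))))

    scaled-surjective : ∀ δ → ¬ δ ≈ 0 → Σ[ s ∈ Sign ] Σ[ j ∈ Fin h ] c * signed s (rep j) ≈ δ
    scaled-surjective δ δ≉0 with signed-surjective (d * δ) dδ≉0
      where
      d = proj₁ c-unit
      dδ≉0 : ¬ d * δ ≈ 0
      dδ≉0 dδ≈0 = δ≉0 (≈-trans (≈-sym (unit-divides c-unit δ))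
                        (≈-trans (*-cong (≈-refl {c}) dδ≈0) (≡⇒≈ (*-zeroʳ c))))
    ... | s , j , e = s , j , ≈-trans (*-cong (≈-refl {c}) e) (unit-divides c-unit δ)

module Z₁₂ = Congruence 11

data BlockType : Set where
  T₁ T₂ T₃ : BlockType

data Position : Set where
  P₀ P₁ P₂ : Position

yCoord : BlockType → Position → ℕ
yCoord _  P₀ = 0
yCoord T₁ P₁ = 1
yCoord T₁ P₂ = 6
yCoord T₂ P₁ = 1
yCoord T₂ P₂ = 3
yCoord T₃ P₁ = 2
yCoord T₃ P₂ = 5

xCoef : BlockType → Position → ℤ
xCoef _  P₀ = +[ 0 ]
xCoef T₁ P₁ = ℤ.- +[ 2 ]
xCoef T₁ P₂ = +[ 2 ]
xCoef T₂ P₁ = +[ 2 ]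
xCoef T₂ P₂ = +[ 3 ]
xCoef T₃ P₁ = ℤ.- +[ 1 ]
xCoef T₃ P₂ = ℤ.- +[ 4 ]

-- The nine differences in Z₁₂ between points of distinct holes (ε ∉ {0, 4, 8}).
data Difference : Set where
  δ1 δ2 δ3 δ5 δ6 δ7 δ9 δ10 δ11 : Difference

value : Difference → ℕ
value δ1  = 1
value δ2  = 2
value δ3  = 3
value δ5  = 5
value δ6  = 6
value δ7  = 7
value δ9  = 9
value δ10 = 10
value δ11 = 11

-- The unit c(ε) such that the two arcs with Z₁₂-difference ε have Z_n-differences ±c(ε)·J.
magnitude : Difference → ℕ
magnitude δ1  = 2
magnitude δ2  = 1
magnitude δ3  = 3
magnitude δ5  = 4
magnitude δ6  = 2
magnitude δ7  = 4
magnitude δ9  = 3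
magnitude δ10 = 1
magnitude δ11 = 2

-- The difference with a given value (δ1 when there is none).
differenceWithValue : ℕ → Difference
differenceWithValue 2  = δ2
differenceWithValue 3  = δ3
differenceWithValue 5  = δ5
differenceWithValue 6  = δ6
differenceWithValue 7  = δ7
differenceWithValue 9  = δ9
differenceWithValue 10 = δ10
differenceWithValue 11 = δ11
differenceWithValue _  = δ1

differenceWithValue-value : ∀ ε → differenceWithValue (value ε % 12) ≡ ε
differenceWithValue-value δ1  = refl
differenceWithValue-value δ2  = refl
differenceWithValue-value δ3  = refl
differenceWithValue-value δ5  = refl
differenceWithValue-value δ6  = refl
differenceWithValue-value δ7  = refl
differenceWithValue-value δ9  = refl
differenceWithValue-value δ10 = refl
differenceWithValue-value δ11 = refl

value-injective : ∀ {ε ε'} → value ε Z₁₂.≈ value ε' → ε ≡ ε'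
value-injective {ε} {ε'} (Z₁₂.mod-eq e) =
  trans (sym (differenceWithValue-value ε))
        (trans (cong differenceWithValue e) (differenceWithValue-value ε'))

hole : Fin 12 → ℕ
hole x = toℕ x % 4

-- Every pair of Z₁₂-coordinates either lies in one hole or differs by a listed ε (computed from
-- the difference); checked by evaluation over all 144 pairs.
Classified : Fin 12 → Fin 12 → Set
Classified x y =
  hole x ≡ hole y ⊎
  toℕ y % 12 ≡ (toℕ x + value (differenceWithValue ((toℕ y + 12 ∸ toℕ x) % 12))) % 12

classified : ∀ x y → Classified x y
classified = toWitness {a? = Fin.all? λ x → Fin.all? λ y → classified? x y} _
  where
  classified? : ∀ x y → Dec (Classified x y)
  classified? x y = (hole x ≟ hole y) ⊎-dec (_ ≟ _)

non-hole-difference : ∀ (x y : Fin 12) → ¬ hole x ≡ hole y →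
                      Σ[ ε ∈ Difference ] toℕ y Z₁₂.≈ toℕ x + value ε
non-hole-difference x y x≁y with classified x y
... | inj₁ x∼y = ⊥-elim (x≁y x∼y)
... | inj₂ e   = _ , Z₁₂.mod-eq e

-- The three points of every translate of a base block lie in distinct holes; checked by evaluation
-- over the twelve translates of each base block.
HolesDistinct : BlockType → Fin 12 → Set
HolesDistinct t b = ¬ holeAt P₀ ≡ holeAt P₁ × ¬ holeAt P₀ ≡ holeAt P₂ × ¬ holeAt P₁ ≡ holeAt P₂
  where
  holeAt : Position → ℕ
  holeAt p = hole ((toℕ b + yCoord t p) mod 12)

holes-distinct? : ∀ t b → Dec (HolesDistinct t b)
holes-distinct? t b = ¬? (_ ≟ _) ×-dec ¬? (_ ≟ _) ×-dec ¬? (_ ≟ _)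

holes-distinct : ∀ t b → HolesDistinct t b
holes-distinct T₁ = toWitness {a? = Fin.all? (holes-distinct? T₁)} _
holes-distinct T₂ = toWitness {a? = Fin.all? (holes-distinct? T₂)} _
holes-distinct T₃ = toWitness {a? = Fin.all? (holes-distinct? T₃)} _

record OrderedPair : Set where
  constructor ⟨_∶_⇒_⟩
  field
    type    : BlockType
    from to : Position
open OrderedPair

-- An arc is named by the Z₁₂-difference ε it realises and the sign of its Z_n-difference.
Arc : Set
Arc = Difference × Sign

arc : Arc → OrderedPair
arc (δ1  , plus)  = ⟨ T₂ ∶ P₀ ⇒ P₁ ⟩
arc (δ1  , minus) = ⟨ T₁ ∶ P₀ ⇒ P₁ ⟩
arc (δ2  , plus)  = ⟨ T₂ ∶ P₁ ⇒ P₂ ⟩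
arc (δ2  , minus) = ⟨ T₃ ∶ P₀ ⇒ P₁ ⟩
arc (δ3  , plus)  = ⟨ T₂ ∶ P₀ ⇒ P₂ ⟩
arc (δ3  , minus) = ⟨ T₃ ∶ P₁ ⇒ P₂ ⟩
arc (δ5  , plus)  = ⟨ T₁ ∶ P₁ ⇒ P₂ ⟩
arc (δ5  , minus) = ⟨ T₃ ∶ P₀ ⇒ P₂ ⟩
arc (δ6  , plus)  = ⟨ T₁ ∶ P₀ ⇒ P₂ ⟩
arc (δ6  , minus) = ⟨ T₁ ∶ P₂ ⇒ P₀ ⟩
arc (δ7  , plus)  = ⟨ T₃ ∶ P₂ ⇒ P₀ ⟩
arc (δ7  , minus) = ⟨ T₁ ∶ P₂ ⇒ P₁ ⟩
arc (δ9  , plus)  = ⟨ T₃ ∶ P₂ ⇒ P₁ ⟩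
arc (δ9  , minus) = ⟨ T₂ ∶ P₂ ⇒ P₀ ⟩
arc (δ10 , plus)  = ⟨ T₃ ∶ P₁ ⇒ P₀ ⟩
arc (δ10 , minus) = ⟨ T₂ ∶ P₂ ⇒ P₁ ⟩
arc (δ11 , plus)  = ⟨ T₁ ∶ P₁ ⇒ P₀ ⟩
arc (δ11 , minus) = ⟨ T₂ ∶ P₁ ⇒ P₀ ⟩

ArcCorrect : Arc → Set
ArcCorrect (ε , s) =
  xCoef t q ≡ xCoef t p ℤ.+ signedℤ s (magnitude ε) × yCoord t q Z₁₂.≈ yCoord t p + value ε
  where
  t = type (arc (ε , s))
  p = from (arc (ε , s))
  q = to (arc (ε , s))

arc-correct : ∀ α → ArcCorrect α
arc-correct (δ1  , plus)  = refl , Z₁₂.mod-eq refl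
arc-correct (δ1  , minus) = refl , Z₁₂.mod-eq refl
arc-correct (δ2  , plus)  = refl , Z₁₂.mod-eq refl
arc-correct (δ2  , minus) = refl , Z₁₂.mod-eq refl
arc-correct (δ3  , plus)  = refl , Z₁₂.mod-eq refl
arc-correct (δ3  , minus) = refl , Z₁₂.mod-eq refl
arc-correct (δ5  , plus)  = refl , Z₁₂.mod-eq refl
arc-correct (δ5  , minus) = refl , Z₁₂.mod-eq refl
arc-correct (δ6  , plus)  = refl , Z₁₂.mod-eq refl
arc-correct (δ6  , minus) = refl , Z₁₂.mod-eq refl
arc-correct (δ7  , plus)  = refl , Z₁₂.mod-eq refl
arc-correct (δ7  , minus) = refl , Z₁₂.mod-eq refl
arc-correct (δ9  , plus)  = refl , Z₁₂.mod-eq refl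
arc-correct (δ9  , minus) = refl , Z₁₂.mod-eq refl
arc-correct (δ10 , plus)  = refl , Z₁₂.mod-eq refl
arc-correct (δ10 , minus) = refl , Z₁₂.mod-eq refl
arc-correct (δ11 , plus)  = refl , Z₁₂.mod-eq refl
arc-correct (δ11 , minus) = refl , Z₁₂.mod-eq refl

arc-through : ∀ t p q → p ≢ q → Σ[ α ∈ Arc ] arc α ≡ ⟨ t ∶ p ⇒ q ⟩
arc-through T₁ P₀ P₁ _ = (δ1  , minus) , refl
arc-through T₁ P₁ P₀ _ = (δ11 , plus)  , refl
arc-through T₁ P₀ P₂ _ = (δ6  , plus)  , refl
arc-through T₁ P₂ P₀ _ = (δ6  , minus) , refl
arc-through T₁ P₁ P₂ _ = (δ5  , plus)  , refl
arc-through T₁ P₂ P₁ _ = (δ7  , minus) , refl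
arc-through T₂ P₀ P₁ _ = (δ1  , plus)  , refl
arc-through T₂ P₁ P₀ _ = (δ11 , minus) , refl
arc-through T₂ P₀ P₂ _ = (δ3  , plus)  , refl
arc-through T₂ P₂ P₀ _ = (δ9  , minus) , refl
arc-through T₂ P₁ P₂ _ = (δ2  , plus)  , refl
arc-through T₂ P₂ P₁ _ = (δ10 , minus) , refl
arc-through T₃ P₀ P₁ _ = (δ2  , minus) , refl
arc-through T₃ P₁ P₀ _ = (δ10 , plus)  , refl
arc-through T₃ P₀ P₂ _ = (δ5  , minus) , refl
arc-through T₃ P₂ P₀ _ = (δ7  , plus)  , refl
arc-through T₃ P₁ P₂ _ = (δ3  , minus) , refl
arc-through T₃ P₂ P₁ _ = (δ9  , plus)  , refl
arc-through _  P₀ P₀ p≢q = ⊥-elim (p≢q refl)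
arc-through _  P₁ P₁ p≢q = ⊥-elim (p≢q refl)
arc-through _  P₂ P₂ p≢q = ⊥-elim (p≢q refl)

blockTypes : List BlockType
blockTypes = T₁ ∷ T₂ ∷ T₃ ∷ []

blockTypes-unique : Unique blockTypes
blockTypes-unique = ((λ ()) ∷ (λ ()) ∷ []) ∷ ((λ ()) ∷ []) ∷ [] ∷ []

∈-blockTypes : ∀ t → t ∈ blockTypes
∈-blockTypes T₁ = here refl
∈-blockTypes T₂ = there (here refl)
∈-blockTypes T₃ = there (there (here refl))

module Construction (k : ℕ) where

  h : ℕ
  h = 2 + 3 * k

  open HalfSystem h

  three-unit : Unit 3
  three-unit = 2 + 2 * k , ≡+N*⇒≈ 1 (triple k)
    where
    triple : ∀ k → (2 + 2 * k) * 3 ≡ 1 + suc ((2 + 3 * k) + (2 + 3 * k)) * 1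
    triple = solve-∀

  magnitude-unit : ∀ ε → Unit (magnitude ε)
  magnitude-unit δ1  = two-unit
  magnitude-unit δ2  = 1 , ≈-refl
  magnitude-unit δ3  = three-unit
  magnitude-unit δ5  = unit-* two-unit two-unit
  magnitude-unit δ6  = two-unit
  magnitude-unit δ7  = unit-* two-unit two-unit
  magnitude-unit δ9  = three-unit
  magnitude-unit δ10 = 1 , ≈-refl
  magnitude-unit δ11 = two-unit

  -- A block is given by its base block, its parameter J = rep j and its translation vector (a, b).
  Param : Set
  Param = BlockType × Fin h × Fin N × Fin 12

  Pt : Set
  Pt = Point N (3 * 4)

  point : Param → Position → Pt
  point (t , j , a , b) p = (toℕ a + ⟦ xCoef t p ⟧ * rep j) mod N , (toℕ b + yCoord t p) mod 12

  block : Param → Block N (3 * 4)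
  block P = blk (point P P₀) (point P P₁) (point P P₂)

  at-position : ∀ P p → point P p ∈B block P
  at-position P P₀ = inj₁ refl
  at-position P P₁ = inj₂ (inj₁ refl)
  at-position P P₂ = inj₂ (inj₂ refl)

  position-of : ∀ P {u} → u ∈B block P → Σ[ p ∈ Position ] point P p ≡ u
  position-of P (inj₁ u≡)        = P₀ , sym u≡
  position-of P (inj₂ (inj₁ u≡)) = P₁ , sym u≡
  position-of P (inj₂ (inj₂ u≡)) = P₂ , sym u≡

  Joins : OrderedPair → Fin h → Fin N → Fin 12 → Pt → Pt → Set
  Joins o j a b u v = point (type o , j , a , b) (from o) ≡ u × point (type o , j , a , b) (to o) ≡ v

  record OnArc (α : Arc) (j : Fin h) (a : Fin N) (b : Fin 12) (u v : Pt) : Set where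
    constructor on-arc
    field joins : Joins (arc α) j a b u v

  arc-differences : ∀ {ε s j a b u v} → OnArc (ε , s) j a b u v →
    toℕ (proj₁ v) ≈ toℕ (proj₁ u) + magnitude ε * signed s (rep j) ×
    toℕ (proj₂ v) Z₁₂.≈ toℕ (proj₂ u) + value ε
  arc-differences {ε} {s} {j} {a} {b} (on-arc (refl , refl)) =
    translate-difference (toℕ a) (scaled-difference {x = xCoef t p} s (magnitude ε) (rep j) x-step) ,
    Z₁₂.translate-difference (toℕ b) y-step
    where
    t = type (arc (ε , s))
    p = from (arc (ε , s))
    x-step = proj₁ (arc-correct (ε , s))
    y-step = proj₂ (arc-correct (ε , s))

  -- The end points of an arc lie in distinct groups, since c(ε)·(±J) ≢ 0.
  arc-groups-distinct : ∀ {α j a b u v} → OnArc α j a b u v → ¬ proj₁ u ≡ proj₁ v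
  arc-groups-distinct {ε , s} {j} {u = u} on refl = Scaled.scaled-≉0 (magnitude-unit ε) s j
    (+-cancelˡ (toℕ (proj₁ u)) (≈-trans (≈-sym (proj₁ (arc-differences on)))
      (≡⇒≈ (sym (+-identityʳ (toℕ (proj₁ u)))))))

  -- A pair of points determines the difference ε of every arc it lies on,
  value-determined : ∀ {ε s ε' s' j j' a a' b b' u v} →
                     OnArc (ε , s) j a b u v → OnArc (ε' , s') j' a' b' u v → ε ≡ ε'
  value-determined on on' = value-injective (Z₁₂.+-cancelˡ _
    (Z₁₂.≈-trans (Z₁₂.≈-sym (proj₂ (arc-differences on))) (proj₂ (arc-differences on'))))

  -- then the sign and J, since c(ε)·(±J) determines both,
  step-determined : ∀ {ε s s' j j' a a' b b' u v} →
                    OnArc (ε , s) j a b u v → OnArc (ε , s') j' a' b' u v → s ≡ s' × j ≡ j'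
  step-determined {ε} on on' = Scaled.scaled-injective (magnitude-unit ε)
    (+-cancelˡ _ (≈-trans (≈-sym (proj₁ (arc-differences on))) (proj₁ (arc-differences on'))))

  -- and finally the translation vector.
  anchor-determined : ∀ {α α' j j' a a' b b' u v} → α ≡ α' → j ≡ j' →
                      OnArc α j a b u v → OnArc α' j' a' b' u v → a ≡ a' × b ≡ b'
  anchor-determined {α} {j = j} refl refl on on' =
    translate-injective (⟦ xCoef (type (arc α)) (from (arc α)) ⟧ * rep j) (cong proj₁ from-same) ,
    Z₁₂.translate-injective (yCoord (type (arc α)) (from (arc α))) (cong proj₂ from-same)
    where
    from-same = trans (proj₁ (OnArc.joins on)) (sym (proj₁ (OnArc.joins on')))

  arc-determined : ∀ {α α' j j' a a' b b' u v} → OnArc α j a b u v → OnArc α' j' a' b' u v →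
                   α ≡ α' × j ≡ j' × a ≡ a' × b ≡ b'
  arc-determined {ε , s} {ε' , s'} on on' = α≡α' , j≡j' , anchor-determined α≡α' j≡j' on on'
    where
    ε≡ε' = value-determined on on'
    steps = step-determined (subst (λ e → OnArc (e , s) _ _ _ _ _) ε≡ε' on) on'
    α≡α' = cong₂ _,_ ε≡ε' (proj₁ steps)
    j≡j' = proj₂ steps

  arc-joining : ∀ {u v} t j a b p q → p ≢ q →
                point (t , j , a , b) p ≡ u → point (t , j , a , b) q ≡ v →
                Σ[ α ∈ Arc ] type (arc α) ≡ t × OnArc α j a b u v
  arc-joining t j a b p q p≢q p↦u q↦v with arc-through t p q p≢q
  ... | α , arc≡ = α , cong type arc≡ , on-arc (subst (λ o → Joins o j a b _ _) (sym arc≡) (p↦u , q↦v))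

  arc-in-block : ∀ {u v} t j a b → ¬ proj₁ u ≡ proj₁ v →
                 u ∈B block (t , j , a , b) → v ∈B block (t , j , a , b) →
                 Σ[ α ∈ Arc ] type (arc α) ≡ t × OnArc α j a b u v
  arc-in-block t j a b u≁v u∈ v∈ with position-of (t , j , a , b) u∈ | position-of (t , j , a , b) v∈
  ... | p , p↦u | q , q↦v = arc-joining t j a b p q
    (λ { refl → u≁v (trans (sym (cong proj₁ p↦u)) (cong proj₁ q↦v)) }) p↦u q↦v

  groups-distinct : ∀ t j a b p q → p ≢ q →
                    ¬ proj₁ (point (t , j , a , b) p) ≡ proj₁ (point (t , j , a , b) q)
  groups-distinct t j a b p q p≢q =
    arc-groups-distinct (proj₂ (proj₂ (arc-joining t j a b p q p≢q refl refl)))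

  -- Every block is admissible: groups differ by the arcs, holes by the finite check.
  block-admissible : ∀ P → AdmissibleBlock N 3 4 (block P)
  block-admissible (t , j , a , b) with holes-distinct t b
  ... | h₀₁ , h₀₂ , h₁₂ =
    (groups-distinct t j a b P₀ P₁ (λ ()) , h₀₁) ,
    (groups-distinct t j a b P₀ P₂ (λ ()) , h₀₂) ,
    (groups-distinct t j a b P₁ P₂ (λ ()) , h₁₂)

  arc-realized : ∀ ε s j (iu iv : Fin N) (xu xv : Fin 12) →
    toℕ iv ≈ toℕ iu + magnitude ε * signed s (rep j) → toℕ xv Z₁₂.≈ toℕ xu + value ε →
    Σ[ a ∈ Fin N ] Σ[ b ∈ Fin 12 ] OnArc (ε , s) j a b (iu , xu) (iv , xv)
  arc-realized ε s j iu iv xu xv iv≈ xv≈ = a , b , on-arc (start , end)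
    where
    t = type (arc (ε , s))
    p = from (arc (ε , s))
    a = (toℕ iu + M * (⟦ xCoef t p ⟧ * rep j)) mod N
    b = (toℕ xu + 11 * yCoord t p) mod 12
    start : point (t , j , a , b) p ≡ (iu , xu)
    start = cong₂ _,_ (translate-to-base iu (⟦ xCoef t p ⟧ * rep j))
                      (Z₁₂.translate-to-base xu (yCoord t p))
    end : point (t , j , a , b) (to (arc (ε , s))) ≡ (iv , xv)
    end = cong₂ _,_
      (translate-to iu iv (scaled-difference {x = xCoef t p} s (magnitude ε) (rep j)
                                            (proj₁ (arc-correct (ε , s)))) iv≈)
      (Z₁₂.translate-to xu xv (proj₂ (arc-correct (ε , s))) xv≈)

  on-arc-∈B : ∀ {α j a b u v} → OnArc α j a b u v →
              u ∈B block (type (arc α) , j , a , b) × v ∈B block (type (arc α) , j , a , b)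
  on-arc-∈B {α} {j} {a} {b} (on-arc (start , end)) =
    subst (_∈B block P) start (at-position P (from (arc α))) ,
    subst (_∈B block P) end (at-position P (to (arc α)))
    where
    P = type (arc α) , j , a , b

  -- An admissible pair has a Z₁₂-difference ε (distinct holes) and a nonzero Z_n-difference, which is
  -- c(ε)·(±J) for some sign and J; the corresponding arc is then realised on the pair.
  pair-covered : ∀ u v → Admissible N 3 4 u v → Σ[ P ∈ Param ] (u ∈B block P × v ∈B block P)
  pair-covered (iu , xu) (iv , xv) (iu≢iv , xu≁xv) =
    let ε , xv≈      = non-hole-difference xu xv xu≁xv
        s , j , step = Scaled.scaled-surjective (magnitude-unit ε) (toℕ iv + M * toℕ iu)
                                                (difference-≉0 iu≢iv)
        iv≈          = ≈-trans (difference-≈ (toℕ iu) (toℕ iv)) (+-cong (≈-refl {toℕ iu}) (≈-sym step))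
        a , b , on   = arc-realized ε s j iu iv xu xv iv≈ xv≈
    in (type (arc (ε , s)) , j , a , b) , on-arc-∈B on

  -- The block through an admissible pair is unique, because the arc through it is.
  pair-unique : ∀ {u v} → Admissible N 3 4 u v → ∀ P P' →
                u ∈B block P → v ∈B block P → u ∈B block P' → v ∈B block P' → P ≡ P'
  pair-unique (u≁v , _) (t , j , a , b) (t' , j' , a' , b') u∈ v∈ u∈' v∈'
    with arc-in-block t j a b u≁v u∈ v∈ | arc-in-block t' j' a' b' u≁v u∈' v∈'
  ... | α , t≡ , on | α' , t'≡ , on' = params-equal (arc-determined on on')
    where
    params-equal : α ≡ α' × j ≡ j' × a ≡ a' × b ≡ b' → (t , j , a , b) ≡ (t' , j' , a' , b')
    params-equal (α≡ , j≡ , a≡ , b≡) =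
      cong₂ _,_ (trans (sym t≡) (trans (cong (λ α → type (arc α)) α≡) t'≡))
                (cong₂ _,_ j≡ (cong₂ _,_ a≡ b≡))

  shift : Param → Param
  shift (t , j , a , b) = t , j , a , shiftZ b

  block-shift : ∀ P → block (shift P) ≡ shiftB (block P)
  block-shift (t , j , a , b) = blk-cong (moved P₀) (moved P₁) (moved P₂)
    where
    blk-cong : ∀ {x x' y y' z z' : Pt} → x ≡ x' → y ≡ y' → z ≡ z' → blk x y z ≡ blk x' y' z'
    blk-cong refl refl refl = refl
    moved : ∀ p → point (t , j , a , shiftZ b) p ≡ shiftP (point (t , j , a , b) p)
    moved p = cong (_ ,_) (sym (Z₁₂.shift-translate b (yCoord t p)))

  params : List Param
  params = cartesianProduct blockTypes
             (cartesianProduct (allFin h) (cartesianProduct (allFin N) (allFin 12)))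

  params-unique : Unique params
  params-unique = cartesianProduct⁺ blockTypes-unique
    (cartesianProduct⁺ (allFin⁺ h) (cartesianProduct⁺ (allFin⁺ N) (allFin⁺ 12)))

  params-complete : ∀ P → P ∈ params
  params-complete (t , j , a , b) = ∈-cartesianProduct⁺ (∈-blockTypes t)
    (∈-cartesianProduct⁺ (∈-allFin j) (∈-cartesianProduct⁺ (∈-allFin a) (∈-allFin b)))

  design : SCHGDD N 3 4
  design = BlockFamily.design params params-unique params-complete block block-admissible
                              pair-covered pair-unique shift block-shift

lemma4p10 : (n : ℕ) → n % 6 ≡ 5 → SCHGDD n 3 4
lemma4p10 n n%6≡5 = subst (λ n → SCHGDD n 3 4) (sym n≡N) (Construction.design (n / 6))
  where
  open ≡-Reasoning
  form : ∀ k → 5 + k * 6 ≡ suc ((2 + 3 * k) + (2 + 3 * k))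
  form = solve-∀
  n≡N : n ≡ suc ((2 + 3 * (n / 6)) + (2 + 3 * (n / 6)))
  n≡N = begin
    n                   ≡⟨ m≡m%n+[m/n]*n n 6 ⟩
    n % 6 + n / 6 * 6   ≡⟨ cong (_+ n / 6 * 6) n%6≡5 ⟩
    5 + n / 6 * 6       ≡⟨ form (n / 6) ⟩
    suc ((2 + 3 * (n / 6)) + (2 + 3 * (n / 6))) ∎
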